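{- Let $s\ge 1$ and $k\ge 1$ be integers and let $a$ be an integer with $a\equiv 2\pmod 4$. Then there is an integer $y\equiv 3\pmod 4$ such that $y^k-y^{k-1}\equiv a \pmod{2^s}$. -}

module Defs where

open import Data.Integer using (ℤ; _-_)
open import Data.Integer.Divisibility using (_∣_)

infix 4 _≡_[modℤ_]
_≡_[modℤ_] : ℤ → ℤ → ℤ → Set
x ≡ y [modℤ m ] = m ∣ (x - y)

-- Write f(y) = y^k - y^(k-1) with k = j + 1.  For odd y and even h, the binomial theorem gives
-- (y + h)^n ≡ y^n + n h (mod 2h), hence f(y + h) ≡ f(y) + h (mod 2h).  Starting from
-- f(3) = 2·3^(k-1) ≡ a (mod 4), a solution modulo 2^m (m ≥ 2) either already works
-- modulo 2^(m+1) or becomes one after adding 2^m, which does not change y mod 4.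
{-# OPTIONS --safe #-}
module Submission where

open import Defs
open import Data.Nat using (ℕ; _≥_; _∸_)
open import Data.Integer using (ℤ; +_; _-_; _^_)
open import Data.Product using (∃; _×_)

open import Data.Nat using (zero; suc; s≤s)
open import Data.Integer using (_+_; _*_; 0ℤ; 1ℤ; _%ℕ_; _/ℕ_)
open import Data.Integer.DivMod using (a≡a%ℕn+[a/ℕn]*n; n%ℕd<d)
open import Data.Integer.Divisibility.Signed
open import Data.Integer.Properties using (+-identityˡ)
open import Data.Integer.Tactic.RingSolver using (solve-∀)
open import Data.Product using (_,_)
open import Data.Sum using (_⊎_; inj₁; inj₂)
open import Relation.Binary.PropositionalEquality using (_≡_; refl; sym; trans; cong; subst)

even-or-odd : ∀ q → + 2 ∣ q ⊎ + 2 ∣ q + 1ℤ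
even-or-odd q with q %ℕ 2 | n%ℕd<d q 2 | a≡a%ℕn+[a/ℕn]*n q 2
... | 0           | _             | q≡ = inj₁ (divides (q /ℕ 2) (trans q≡ (+-identityˡ _)))
... | 1           | _             | q≡ = inj₂ (divides (q /ℕ 2 + 1ℤ) (trans (cong (_+ 1ℤ) q≡) (carry (q /ℕ 2))))
  where
  carry : ∀ r → + 1 + r * + 2 + 1ℤ ≡ (r + 1ℤ) * + 2
  carry = solve-∀
... | suc (suc _) | s≤s (s≤s ()) | _

^-odd : ∀ {y} → + 2 ∣ y - 1ℤ → ∀ n → + 2 ∣ y ^ n - 1ℤ
^-odd _        zero    = divides 0ℤ refl
^-odd {y} y-odd (suc n) =
  subst (+ 2 ∣_) (sym (split y (y ^ n))) (∣m∣n⇒∣m+n (∣n⇒∣m*n y (^-odd y-odd n)) y-odd)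
  where
  split : ∀ y z → y * z - 1ℤ ≡ y * (z - 1ℤ) + (y - 1ℤ)
  split = solve-∀

f : ℕ → ℤ → ℤ
f j y = y ^ suc j - y ^ j

module _ {y h : ℤ} (y-odd : + 2 ∣ y - 1ℤ) (h-even : + 2 ∣ h) where

  ^-shift : ∀ n → + 2 * h ∣ (y + h) ^ n - (y ^ n + + n * h)
  ^-shift zero    = divides 0ℤ (vanish h)
    where
    vanish : ∀ h → 1ℤ - (1ℤ + 0ℤ * h) ≡ 0ℤ * (+ 2 * h)
    vanish = solve-∀
  ^-shift (suc n) =
    subst (+ 2 * h ∣_) (sym (expand y h ((y + h) ^ n) (y ^ n) (+ n)))
      (∣m∣n⇒∣m+n (∣m∣n⇒∣m+n (∣m∣n⇒∣m+n
        (∣n⇒∣m*n (y + h) (^-shift n))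
        (*-monoˡ-∣ h (^-odd y-odd n)))
        (∣n⇒∣m*n (+ n) (*-monoˡ-∣ h y-odd)))
        (∣n⇒∣m*n (+ n) (*-monoˡ-∣ h h-even)))
    where
    expand : ∀ y h Y P N →
      (y + h) * Y - (y * P + (1ℤ + N) * h) ≡
      (y + h) * (Y - (P + N * h)) + (P - 1ℤ) * h + N * ((y - 1ℤ) * h) + N * (h * h)
    expand = solve-∀

  f-shift : ∀ j → + 2 * h ∣ f j (y + h) - (f j y + h)
  f-shift j =
    subst (+ 2 * h ∣_) (sym (telescope (y ^ suc j) (y ^ j) ((y + h) ^ suc j) ((y + h) ^ j) (+ j) h))
      (∣m∣n⇒∣m-n (^-shift (suc j)) (^-shift j))
    where
    telescope : ∀ A B A' B' N h →
      A' - B' - (A - B + h) ≡ (A' - (A + (1ℤ + N) * h)) - (B' - (B + N * h))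
    telescope = solve-∀

f-at-3 : ∀ j {a} → + 4 ∣ a - + 2 → + 4 ∣ f j (+ 3) - a
f-at-3 j {a} a≡2 =
  subst (+ 4 ∣_) (sym (regroup ((+ 3) ^ j) a))
    (∣m∣n⇒∣m-n (*-monoʳ-∣ (+ 2) (^-odd (divides 1ℤ refl) j)) a≡2)
  where
  regroup : ∀ P a → + 3 * P - P - a ≡ + 2 * (P - 1ℤ) - (a - + 2)
  regroup = solve-∀

∣⇒2*∣⊎2*∣+ : ∀ {h x} → h ∣ x → + 2 * h ∣ x ⊎ + 2 * h ∣ x + h
∣⇒2*∣⊎2*∣+ {h} {x} (divides q x≡q*h) with even-or-odd q
... | inj₁ 2∣q   = inj₁ (subst (+ 2 * h ∣_) (sym x≡q*h) (*-monoˡ-∣ h 2∣q))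
... | inj₂ 2∣q+1 = inj₂ (subst (+ 2 * h ∣_) (sym (trans (cong (_+ h) x≡q*h) (absorb q h))) (*-monoˡ-∣ h 2∣q+1))
  where
  absorb : ∀ q h → q * h + h ≡ (q + 1ℤ) * h
  absorb = solve-∀

≡3⇒odd : ∀ {y} → + 4 ∣ y - + 3 → + 2 ∣ y - 1ℤ
≡3⇒odd {y} y≡3 = subst (+ 2 ∣_) (sym (shift y)) (∣m∣n⇒∣m+n (∣-trans (divides (+ 2) refl) y≡3) (divides 1ℤ refl))
  where
  shift : ∀ y → y - 1ℤ ≡ y - + 3 + + 2
  shift = solve-∀

f-lift : ∀ j a y {h} → + 4 ∣ h → + 4 ∣ y - + 3 → h ∣ f j y - a →
  ∃ λ y′ → + 4 ∣ y′ - + 3 × + 2 * h ∣ f j y′ - a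
f-lift j a y {h} 4∣h y≡3 h∣fy-a with ∣⇒2*∣⊎2*∣+ h∣fy-a
... | inj₁ 2h∣fy-a   = y , y≡3 , 2h∣fy-a
... | inj₂ 2h∣fy-a+h =
  y + h ,
  subst (+ 4 ∣_) (sym (shift-3 y h)) (∣m∣n⇒∣m+n y≡3 4∣h) ,
  subst (+ 2 * h ∣_) (sym (split (f j (y + h)) (f j y) a h))
    (∣m∣n⇒∣m+n (f-shift {y} {h} (≡3⇒odd {y} y≡3) (∣-trans (divides (+ 2) refl) 4∣h) j) 2h∣fy-a+h)
  where
  shift-3 : ∀ y h → y + h - + 3 ≡ y - + 3 + h
  shift-3 = solve-∀
  split : ∀ F′ F a h → F′ - a ≡ F′ - (F + h) + (F - a + h)
  split = solve-∀

4∣2^[2+m] : ∀ m → + 4 ∣ (+ 2) ^ suc (suc m)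
4∣2^[2+m] m = divides ((+ 2) ^ m) (regroup ((+ 2) ^ m))
  where
  regroup : ∀ t → + 2 * (+ 2 * t) ≡ t * + 4
  regroup = solve-∀

f-solution : ∀ j a → + 4 ∣ a - + 2 → ∀ m →
  ∃ λ y → + 4 ∣ y - + 3 × (+ 2) ^ suc (suc m) ∣ f j y - a
f-solution j a a≡2 zero    = + 3 , divides 0ℤ refl , f-at-3 j a≡2
f-solution j a a≡2 (suc m) with f-solution j a a≡2 m
... | y , y≡3 , y-solves = f-lift j a y (4∣2^[2+m] m) y≡3 y-solves

lemma1 : (s k : ℕ) → s ≥ 1 → k ≥ 1 → (a : ℤ) → a ≡ + 2 [modℤ + 4 ] →
    ∃ λ (y : ℤ) → (y ≡ + 3 [modℤ + 4 ]) × ((y ^ k) - (y ^ (k ∸ 1)) ≡ a [modℤ (+ 2) ^ s ])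
lemma1 (suc s) (suc j) _ _ a a≡2 with f-solution j a (∣ᵤ⇒∣ a≡2) s
... | y , y≡3 , y-solves = y , ∣⇒∣ᵤ y≡3 , ∣⇒∣ᵤ (∣-trans (divides (+ 2) refl) y-solves)
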